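{- Let $\mathcal{C}$ be a nice clustering for a facility location instance $(F,D)$, and let $\alpha,\beta$ be constructed from $\mathcal{C}$ as in the context. Define $\hat\alpha_j:=\alpha_j/2^{10}$ for all $j\in D$. Then $(\hat\alpha,\beta)$ is a feasible solution to the LP: maximize $\sum_{j\in D}\alpha'_j$ subject to $\sum_{j\in D}\beta'_{ij}\le f_i$ for all $i\in F$; $\alpha'_j-\beta'_{ij}\le d_{ij}$ for all $i\in F,j\in D$; $\alpha'_j,\beta'_{ij}\ge0$ for all $i\in F,j\in D$.
   Context: Facility location: finite facility set $F$, finite client set $D$, in a common metric space; $d_{ij}>0$ is the distance between facility $i$ and client $j$ (triangle inequality holds), $f_i\ge0$ the opening cost of facility $i$. Clusters: a cluster is a pair $C=(i,A)$ with $i\in F$, $A\subseteq D$, designated critical or satellite; satellite clusters have exactly one client. $cost(C)=\sum_{j\in A}d_{ij}$ if satellite, $f_i+\sum_{j\in A}d_{ij}$ if critical; $cost_{avg}(C)=cost(C)/|A|$. A clustering is a collection $\mathcal{C}$ of clusters in which every client of $D$ lies in exactly one cluster and, for each facility $i$ with $\mathcal{C}(i)$ (clusters of $\mathcal{C}$ with facility $i$) nonempty, exactly one cluster of $\mathcal{C}(i)$ is critical. Each $C\in\mathcal{C}$ has a level $\ell(C)\in\mathbb{Z}$; $\ell(j)=\ell(C)$ for clients $j$ of $C$. $\kappa^*_{ij}$ is the unique integer with $2^{\kappa^*_{ij}-4}\le d_{ij}<2^{\kappa^*_{ij}-3}$. A cluster $C=(i,A)$ (not necessarily in $\mathcal{C}$)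 is blocking at level $k$ w.r.t. $\mathcal{C}$ if (a) $cost_{avg}(C)<2^{k-3}$; (b) $\ell(j)>k\ge\kappa^*_{ij}$ for all $j\in A$; (c) if $C$ is satellite, some critical $C^*\in\mathcal{C}(i)$ has $\ell(C^*)\le k$; if $C$ is critical, $k\le\ell(C')$ for all $C'\in\mathcal{C}(i)$. $\mathcal{C}$ is nice if (I1) $cost_{avg}(C)<2^{\ell(C)}$ for all $C\in\mathcal{C}$; (I2) for each $i$ with $\mathcal{C}(i)\ne\emptyset$ the critical cluster $C^*\in\mathcal{C}(i)$ has $\ell(C^*)\le\ell(C)$ for all $C\in\mathcal{C}(i)$; (I3) $\ell(j)\ge\kappa^*_{ij}$ for every $C=(i,A)\in\mathcal{C}$, $j\in A$; (I4) no cluster is blocking at any level w.r.t. $\mathcal{C}$. Construction: for each client $j$, $\alpha_j=2^{\ell(j)}$; for every facility $i\in F$ and client $j\in D$, $\beta_{ij}=\max(0,\alpha_j/2^{10}-d_{ij})$.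
   Formalization: The distances $d_{ij}$ and the opening costs $f_i$ are rational. -}

module Defs where

open import Data.Nat using (ℕ; zero; suc)
open import Data.Integer using (ℤ; +_; -[1+_])
import Data.Integer as ℤ
open import Data.Rational using (ℚ; 0ℚ; 1ℚ; ½; _+_; _*_; _-_; _/_; _⊔_; _≤_; _<_)
open import Data.Fin using (Fin; zero; suc)
open import Data.Fin.Subset using (Subset; _∈_; ∣_∣)
open import Data.Vec using (lookup)
open import Data.Bool using (Bool; true; false; if_then_else_)
open import Data.Product using (Σ; ∃; _×_)
open import Relation.Binary.PropositionalEquality using (_≡_)
open import Relation.Nullary using (¬_)

sumFin : (n : ℕ) → (Fin n → ℚ) → ℚ
sumFin zero    f = 0ℚ
sumFin (suc n) f = f zero + sumFin n (λ k → f (suc k))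

pow2ℕ : ℕ → ℚ
pow2ℕ zero    = 1ℚ
pow2ℕ (suc n) = (+ 2 / 1) * pow2ℕ n

half^ : ℕ → ℚ
half^ zero    = 1ℚ
half^ (suc n) = ½ * half^ n

pow2 : ℤ → ℚ
pow2 (+ n)      = pow2ℕ n
pow2 -[1+ n ]   = half^ (suc n)

-- A facility location instance with facilities Fin nF and clients Fin nD,
-- inside a common metric space: d i j > 0, f i ≥ 0, and the triangle
-- inequality restricted to facility/client distances.
record Instance (nF nD : ℕ) : Set where
  field
    d     : Fin nF → Fin nD → ℚ
    f     : Fin nF → ℚ
    d-pos : ∀ i j → 0ℚ < d i j
    f-nonneg : ∀ i → 0ℚ ≤ f i
    triangle : ∀ i i' j j' → d i j ≤ (d i j' + d i' j') + d i' j

-- a cluster (i, A), critical or satellite (critical = false)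
record Cluster (nF nD : ℕ) : Set where
  constructor cluster
  field
    fac      : Fin nF
    clients  : Subset nD
    critical : Bool
open Cluster public

module _ {nF nD : ℕ} (I : Instance nF nD) where
  open Instance I

  -- well-formed cluster: A nonempty (so cost_avg is defined), and a
  -- satellite cluster has exactly one client
  WFCluster : Cluster nF nD → Set
  WFCluster C = (1 Data.Nat.≤ ∣ clients C ∣) × (critical C ≡ false → ∣ clients C ∣ ≡ 1)

  cost : Cluster nF nD → ℚ
  cost C = (if critical C then f (fac C) else 0ℚ)
         + sumFin nD (λ j → if lookup (clients C) j then d (fac C) j else 0ℚ)

  -- cost(C) / |A|  (value 0 for an empty client set, never used)
  costAvg : Cluster nF nD → ℚ
  costAvg C with ∣ clients C ∣
  ... | zero  = 0ℚ
  ... | suc n = cost C * (+ 1 / suc n)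

  IsKappa : Fin nF → Fin nD → ℤ → Set
  IsKappa i j k = pow2 (k ℤ.- + 4) ≤ d i j × d i j < pow2 (k ℤ.- + 3)

  KappaLe : Fin nF → Fin nD → ℤ → Set
  KappaLe i j k = ∃ λ κ → IsKappa i j κ × κ ℤ.≤ k

  record Clustering : Set where
    field
      m       : ℕ
      cl      : Fin m → Cluster nF nD
      level   : Fin m → ℤ
      wf      : ∀ c → WFCluster (cl c)
      assign  : Fin nD → Fin m
      assign-spec₁ : ∀ j → j ∈ clients (cl (assign j))
      assign-spec₂ : ∀ j c → j ∈ clients (cl c) → c ≡ assign j
      crit-exists : ∀ i → (∃ λ c → fac (cl c) ≡ i) →
                    ∃ λ c → fac (cl c) ≡ i × critical (cl c) ≡ true
      crit-unique : ∀ c c' → fac (cl c) ≡ fac (cl c') →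
                    critical (cl c) ≡ true → critical (cl c') ≡ true → c ≡ c'

    clientLevel : Fin nD → ℤ
    clientLevel j = level (assign j)

  open Clustering public

  module _ (𝒞 : Clustering) where

    Blocking : ℤ → Cluster nF nD → Set
    Blocking k C =
        WFCluster C
      × costAvg C < pow2 (k ℤ.- + 3)
      × (∀ j → j ∈ clients C → (k ℤ.< clientLevel 𝒞 j) × KappaLe (fac C) j k)
      × (critical C ≡ false →
           ∃ λ c → fac (cl 𝒞 c) ≡ fac C × critical (cl 𝒞 c) ≡ true × level 𝒞 c ℤ.≤ k)
      × (critical C ≡ true →
           ∀ c → fac (cl 𝒞 c) ≡ fac C → k ℤ.≤ level 𝒞 c)

    record Nice : Set where
      field
        I1 : ∀ c → costAvg (cl 𝒞 c) < pow2 (level 𝒞 c)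
        I2 : ∀ c c' → critical (cl 𝒞 c) ≡ true → fac (cl 𝒞 c) ≡ fac (cl 𝒞 c') →
             level 𝒞 c ℤ.≤ level 𝒞 c'
        I3 : ∀ c j → j ∈ clients (cl 𝒞 c) → KappaLe (fac (cl 𝒞 c)) j (level 𝒞 c)
        I4 : ∀ k C → ¬ Blocking k C

    α : Fin nD → ℚ
    α j = pow2 (clientLevel 𝒞 j)

    β : Fin nF → Fin nD → ℚ
    β i j = 0ℚ ⊔ (α j * (+ 1 / 1024) - d i j)

    αhat : Fin nD → ℚ
    αhat j = α j * (+ 1 / 1024)

  LPFeasible : (Fin nD → ℚ) → (Fin nF → Fin nD → ℚ) → Set
  LPFeasible α' β' =
      (∀ i → sumFin nD (β' i) ≤ f i)
    × (∀ i j → α' j - β' i j ≤ d i j)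
    × (∀ j → 0ℚ ≤ α' j)
    × (∀ i j → 0ℚ ≤ β' i j)

{-# OPTIONS --safe #-}
-- Suppose Σ_j β_ij > f_i for some facility i, and let P be the set of clients j contributing to
-- β_i, i.e. with d_ij < α̂_j; P is nonempty since f_i ≥ 0.  Niceness forbids blocking satellite
-- clusters, and the triangle inequality turns this into two level bounds: the levels of any two
-- clients of P differ by at most one, and every cluster at i has level at least ℓ(j₀) for each
-- j₀ ∈ P.  Then the critical cluster (i, P) costs f_i + Σ_P d_ij < Σ_P α̂_j ≤ |P| 2^{ℓ(j₀)-5},
-- so it is blocking at level ℓ(j₀) - 2, contradicting (I4).  The other LP constraints hold
-- because β is a maximum with 0.  The level κ*_ij is obtained from a binary logarithm of the
-- positive rational d_ij, which exists by the archimedean property.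
module Submission where

open import Data.Bool using (true; false; if_then_else_)
open import Data.Empty using (⊥-elim)
open import Data.Fin using (Fin; zero; suc)
open import Data.Fin.Subset using (Subset; _∈_; _⊆_; ∣_∣; ⁅_⁆; ⊥)
open import Data.Fin.Subset.Properties using (∣⁅x⁆∣≡1; x∈⁅y⁆⇒x≡y; p⊆q⇒∣p∣≤∣q∣)
open import Data.Integer as ℤ using (ℤ; +_; -[1+_])
import Data.Integer.Properties as ℤ
import Data.Integer.Tactic.RingSolver as ℤ-Solver
open import Data.Nat as ℕ using (ℕ; zero; suc)
import Data.Nat.Properties as ℕ
open import Data.Nat.Coprimality using (1-coprimeTo)
open import Data.Product using (∃; _×_; _,_; proj₁; proj₂)
open import Data.Rational
  using (ℚ; Positive; positive; nonNegative; 0ℚ; 1ℚ; ½; _+_; _*_; -_; _-_; _⊔_; _/_; _≤_; _<_; 1/_; ↥_; mkℚ; *<*)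
open import Data.Rational.Literals using (fromℤ)
open import Data.Rational.Properties
open import Data.Rational.Solver using (module +-*-Solver)
import Data.Rational.Unnormalised as ℚᵘ
import Data.Rational.Unnormalised.Properties as ℚᵘ
open import Data.Vec using (lookup; tabulate; _∷_; [])
open import Data.Vec.Properties using (lookup∘tabulate; lookup⇒[]=; []=⇒lookup)
open import Algebra.Bundles using (CommutativeMonoid)
open import Algebra.Properties.CommutativeSemigroup
  (CommutativeMonoid.commutativeSemigroup +-0-commutativeMonoid)
  using () renaming (interchange to +-interchange)
open import Relation.Binary.PropositionalEquality
open import Relation.Nullary using (¬_; Dec; yes; no; does)
open import Relation.Nullary.Decidable using (dec-true)

open import Defs

i-1<i : ∀ i → i ℤ.- + 1 ℤ.< i
i-1<i i = ℤ.i≤pred[j]⇒i<j (ℤ.≤-reflexive (ℤ.+-comm i (ℤ.- + 1)))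

i<j⇒i≤j-1 : ∀ {i j} → i ℤ.< j → i ℤ.≤ j ℤ.- + 1
i<j⇒i≤j-1 {i} {j} i<j = subst (i ℤ.≤_) (ℤ.+-comm (ℤ.- + 1) j) (ℤ.i<j⇒i≤pred[j] i<j)

i<j⇒i+1≤j : ∀ {i j} → i ℤ.< j → i ℤ.+ + 1 ℤ.≤ j
i<j⇒i+1≤j {i} {j} i<j = subst (ℤ._≤ j) (ℤ.+-comm (+ 1) i) (ℤ.i<j⇒suc[i]≤j i<j)

0<*-pos : ∀ c .{{_ : Positive c}} {x} → 0ℚ < x → 0ℚ < c * x
0<*-pos c {x} 0<x = subst (_< c * x) (*-zeroʳ c) (*-monoʳ-<-pos c 0<x)

0⊔[p-q]≡p-q : ∀ {p q} → q ≤ p → 0ℚ ⊔ (p - q) ≡ p - q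
0⊔[p-q]≡p-q {p} {q} q≤p = p≤q⇒p⊔q≡q (subst (_≤ p - q) (+-inverseʳ q) (+-monoˡ-≤ (- q) q≤p))

0⊔[p-q]≡0 : ∀ {p q} → p ≤ q → 0ℚ ⊔ (p - q) ≡ 0ℚ
0⊔[p-q]≡0 {p} {q} p≤q = p≥q⇒p⊔q≡p (subst (p - q ≤_) (+-inverseʳ q) (+-monoˡ-≤ (- q) p≤q))

p-[0⊔[p-q]]≤q : ∀ p q → p - (0ℚ ⊔ (p - q)) ≤ q
p-[0⊔[p-q]]≤q p q = begin
  p - (0ℚ ⊔ (p - q))  ≤⟨ +-monoʳ-≤ p (neg-antimono-≤ (p≤q⊔p 0ℚ (p - q))) ⟩
  p - (p - q)         ≡⟨ solve 2 (λ p q → p :- (p :- q) := q) refl p q ⟩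
  q                   ∎
  where
  open ≤-Reasoning
  open +-*-Solver

fromℕ : ℕ → ℚ
fromℕ n = fromℤ (+ n)

fromℕ-suc : ∀ n → fromℕ (suc n) ≡ 1ℚ + fromℕ n
fromℕ-suc n = toℚᵘ-injective (ℚᵘ.≃-sym (ℚᵘ.≃-trans (toℚᵘ-homo-+ 1ℚ (fromℕ n)) (ℚᵘ.*≡* eq)))
  where
  eq : (+ 1 ℤ.+ + n ℤ.* + 1) ℤ.* + 1 ≡ + suc n ℤ.* + 1
  eq rewrite ℤ.*-identityʳ (+ n) = refl

fromℕ-inverse : ∀ n → fromℕ (suc n) * (+ 1 / suc n) ≡ 1ℚ
fromℕ-inverse n =
  trans (cong (fromℕ (suc n) *_) (normalize-coprime (1-coprimeTo (suc n)))) (*-inverseʳ (fromℕ (suc n)))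

pow2ℕ-suc : ∀ n → pow2ℕ (suc n) ≡ pow2ℕ n + pow2ℕ n
pow2ℕ-suc n = solve 1 (λ x → con (+ 2 / 1) :* x := x :+ x) refl (pow2ℕ n)
  where open +-*-Solver

pow2-suc : ∀ z → pow2 (z ℤ.+ + 1) ≡ pow2 z + pow2 z
pow2-suc (+ n) rewrite ℕ.+-comm n 1 = pow2ℕ-suc n
pow2-suc -[1+ zero ] = refl
pow2-suc -[1+ suc n ] = solve 1 (λ x → x := con ½ :* x :+ con ½ :* x) refl (half^ (suc n))
  where open +-*-Solver

pow2-double : ∀ x a → pow2 (x ℤ.+ a) + pow2 (x ℤ.+ a) ≡ pow2 (x ℤ.+ (a ℤ.+ + 1))
pow2-double x a = trans (sym (pow2-suc (x ℤ.+ a))) (cong pow2 (ℤ.+-assoc x a (+ 1)))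

pow2-pos : ∀ z → 0ℚ < pow2 z
pow2-pos (+ zero)     = positive⁻¹ 1ℚ
pow2-pos (+ suc n)    = 0<*-pos (+ 2 / 1) (pow2-pos (+ n))
pow2-pos -[1+ zero ]  = positive⁻¹ ½
pow2-pos -[1+ suc n ] = 0<*-pos ½ (pow2-pos -[1+ n ])

1≤pow2ℕ : ∀ n → 1ℚ ≤ pow2ℕ n
1≤pow2ℕ zero    = ≤-refl
1≤pow2ℕ (suc n) = begin
  1ℚ                 ≤⟨ 1≤pow2ℕ n ⟩
  pow2ℕ n            ≡⟨ sym (+-identityʳ (pow2ℕ n)) ⟩
  pow2ℕ n + 0ℚ       ≤⟨ +-monoʳ-≤ (pow2ℕ n) (<⇒≤ (pow2-pos (+ n))) ⟩
  pow2ℕ n + pow2ℕ n  ≡⟨ sym (pow2ℕ-suc n) ⟩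
  pow2ℕ (suc n)      ∎
  where open ≤-Reasoning

pow2-+ℕ : ∀ z n → pow2 (z ℤ.+ + n) ≡ pow2ℕ n * pow2 z
pow2-+ℕ z zero rewrite ℤ.+-identityʳ z = sym (*-identityˡ (pow2 z))
pow2-+ℕ z (suc n) = begin
  pow2 (z ℤ.+ + suc n)          ≡⟨ cong pow2 (sym (ℤ.+-assoc z (+ 1) (+ n))) ⟩
  pow2 ((z ℤ.+ + 1) ℤ.+ + n)    ≡⟨ pow2-+ℕ (z ℤ.+ + 1) n ⟩
  pow2ℕ n * pow2 (z ℤ.+ + 1)    ≡⟨ cong (pow2ℕ n *_) (pow2-suc z) ⟩
  pow2ℕ n * (pow2 z + pow2 z)
    ≡⟨ solve 2 (λ p x → p :* (x :+ x) := (con (+ 2 / 1) :* p) :* x) refl (pow2ℕ n) (pow2 z) ⟩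
  pow2ℕ (suc n) * pow2 z        ∎
  where
  open ≡-Reasoning
  open +-*-Solver

pow2-mono-≤ : ∀ {z w} → z ℤ.≤ w → pow2 z ≤ pow2 w
pow2-mono-≤ {z} {w} z≤w = begin
  pow2 z               ≡⟨ sym (*-identityˡ (pow2 z)) ⟩
  1ℚ * pow2 z          ≤⟨ *-monoʳ-≤-nonNeg (pow2 z) {{nonNegative 0≤2ᶻ}} (1≤pow2ℕ n) ⟩
  pow2ℕ n * pow2 z     ≡⟨ sym (pow2-+ℕ z n) ⟩
  pow2 (z ℤ.+ + n)     ≡⟨ cong pow2 z+n≡w ⟩
  pow2 w               ∎
  where
  open ≤-Reasoning
  n = ℤ.∣ w ℤ.- z ∣
  0≤2ᶻ = <⇒≤ (pow2-pos z)
  z+[w-z]≡w : ∀ z w → z ℤ.+ (w ℤ.- z) ≡ w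
  z+[w-z]≡w = ℤ-Solver.solve-∀
  z+n≡w : z ℤ.+ + n ≡ w
  z+n≡w = trans (cong (λ u → z ℤ.+ u) (ℤ.0≤i⇒+∣i∣≡i (ℤ.i≤j⇒0≤j-i z≤w))) (z+[w-z]≡w z w)

pow2-offset-≤ : ∀ x {a b} → a ℤ.≤ b → pow2 (x ℤ.+ a) ≤ pow2 (x ℤ.+ b)
pow2-offset-≤ x a≤b = pow2-mono-≤ (ℤ.+-monoʳ-≤ x a≤b)

pow2-/1024 : ∀ z → pow2 z * (+ 1 / 1024) ≡ pow2 (z ℤ.- + 10)
pow2-/1024 z = begin
  pow2 z * (+ 1 / 1024)                        ≡⟨ cong (λ w → pow2 w * (+ 1 / 1024)) (sym (z-10+10≡z z)) ⟩
  pow2 ((z ℤ.- + 10) ℤ.+ + 10) * (+ 1 / 1024)  ≡⟨ cong (_* (+ 1 / 1024)) (pow2-+ℕ (z ℤ.- + 10) 10) ⟩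
  (pow2ℕ 10 * y) * (+ 1 / 1024)
    ≡⟨ solve 1 (λ y → (con (pow2ℕ 10) :* y) :* con (+ 1 / 1024) := y) refl y ⟩
  y                                            ∎
  where
  open ≡-Reasoning
  open +-*-Solver
  y = pow2 (z ℤ.- + 10)
  z-10+10≡z : ∀ z → (z ℤ.- + 10) ℤ.+ + 10 ≡ z
  z-10+10≡z = ℤ-Solver.solve-∀

fromℕ≤pow2ℕ : ∀ n → fromℕ n ≤ pow2ℕ n
fromℕ≤pow2ℕ zero    = <⇒≤ (pow2-pos (+ 0))
fromℕ≤pow2ℕ (suc n) = begin
  fromℕ (suc n)      ≡⟨ fromℕ-suc n ⟩
  1ℚ + fromℕ n       ≤⟨ +-mono-≤ (1≤pow2ℕ n) (fromℕ≤pow2ℕ n) ⟩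
  pow2ℕ n + pow2ℕ n  ≡⟨ sym (pow2ℕ-suc n) ⟩
  pow2ℕ (suc n)      ∎
  where open ≤-Reasoning

q<fromℕ[1+∣↥q∣] : ∀ q → q < fromℕ (suc ℤ.∣ ↥ q ∣)
q<fromℕ[1+∣↥q∣] (mkℚ -[1+ n ] d-1 _) = *<* ℤ.-<+
q<fromℕ[1+∣↥q∣] (mkℚ (+ n) d-1 _)    = *<* (begin-strict
  + n ℤ.* + 1                  ≡⟨ ℤ.*-identityʳ (+ n) ⟩
  + n                          <⟨ ℤ.+<+ (ℕ.n<1+n n) ⟩
  + suc n                      ≤⟨ ℤ.+≤+ (ℕ.m≤m*n (suc n) (suc d-1)) ⟩
  + suc n ℤ.* + suc d-1        ∎)
  where open ℤ.≤-Reasoning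

pow2ℕ-unbounded : ∀ q → ∃ λ n → q < pow2ℕ n
pow2ℕ-unbounded q = suc ℤ.∣ ↥ q ∣ , <-≤-trans (q<fromℕ[1+∣↥q∣] q) (fromℕ≤pow2ℕ _)

pow2-below : ∀ q → 0ℚ < q → ∃ λ n → pow2 (ℤ.- + n) < q
pow2-below q 0<q = n , (begin-strict
  2⁻ⁿ                  ≡⟨ sym (*-identityˡ 2⁻ⁿ) ⟩
  1ℚ * 2⁻ⁿ             ≡⟨ cong (_* 2⁻ⁿ) (sym (*-inverseˡ q)) ⟩
  ((1/ q) * q) * 2⁻ⁿ   ≡⟨ *-assoc (1/ q) q 2⁻ⁿ ⟩
  (1/ q) * (q * 2⁻ⁿ)   <⟨ *-monoˡ-<-pos (q * 2⁻ⁿ) {{positive 0<q2⁻ⁿ}} 1/q<2ⁿ ⟩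
  pow2ℕ n * (q * 2⁻ⁿ)  ≡⟨ solve 3 (λ p q h → p :* (q :* h) := q :* (p :* h)) refl (pow2ℕ n) q 2⁻ⁿ ⟩
  q * (pow2ℕ n * 2⁻ⁿ)  ≡⟨ cong (q *_) 2ⁿ2⁻ⁿ≡1 ⟩
  q * 1ℚ               ≡⟨ *-identityʳ q ⟩
  q                    ∎)
  where
  open ≤-Reasoning
  open +-*-Solver
  instance _ = pos⇒nonZero q {{positive 0<q}}
  n = proj₁ (pow2ℕ-unbounded (1/ q))
  1/q<2ⁿ = proj₂ (pow2ℕ-unbounded (1/ q))
  2⁻ⁿ = pow2 (ℤ.- + n)
  0<q2⁻ⁿ : 0ℚ < q * 2⁻ⁿ
  0<q2⁻ⁿ = 0<*-pos q {{positive 0<q}} (pow2-pos (ℤ.- + n))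
  2ⁿ2⁻ⁿ≡1 : pow2ℕ n * 2⁻ⁿ ≡ 1ℚ
  2ⁿ2⁻ⁿ≡1 = trans (sym (pow2-+ℕ (ℤ.- + n) n)) (cong pow2 (ℤ.+-inverseˡ (+ n)))

pow2-bracket-search : ∀ q n t → pow2 t ≤ q → q < pow2 (t ℤ.+ + n) →
                      ∃ λ s → pow2 s ≤ q × q < pow2 (s ℤ.+ + 1)
pow2-bracket-search q zero t 2ᵗ≤q q<2ᵗ =
  ⊥-elim (<-irrefl refl (≤-<-trans 2ᵗ≤q (subst (λ z → q < pow2 z) (ℤ.+-identityʳ t) q<2ᵗ)))
pow2-bracket-search q (suc n) t 2ᵗ≤q q<2ᵗ⁺ⁿ⁺¹ with q <? pow2 (t ℤ.+ + 1)
... | yes q<2ᵗ⁺¹ = t , 2ᵗ≤q , q<2ᵗ⁺¹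
... | no  q≮2ᵗ⁺¹ = pow2-bracket-search q n (t ℤ.+ + 1) (≮⇒≥ q≮2ᵗ⁺¹)
                     (subst (λ z → q < pow2 z) (sym (ℤ.+-assoc t (+ 1) (+ n))) q<2ᵗ⁺ⁿ⁺¹)

pow2-bracket : ∀ q → 0ℚ < q → ∃ λ s → pow2 s ≤ q × q < pow2 (s ℤ.+ + 1)
pow2-bracket q 0<q =
  pow2-bracket-search q (k ℕ.+ n) (ℤ.- + k) (<⇒≤ 2⁻ᵏ<q)
    (subst (λ z → q < pow2 z) (sym (-x+[x+y]≡y (+ k) (+ n))) q<2ⁿ)
  where
  k = proj₁ (pow2-below q 0<q)
  2⁻ᵏ<q = proj₂ (pow2-below q 0<q)
  n = proj₁ (pow2ℕ-unbounded q)
  q<2ⁿ = proj₂ (pow2ℕ-unbounded q)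
  -x+[x+y]≡y : ∀ x y → ℤ.- x ℤ.+ (x ℤ.+ y) ≡ y
  -x+[x+y]≡y = ℤ-Solver.solve-∀

sumFin-mono : ∀ n {f g : Fin n → ℚ} → (∀ j → f j ≤ g j) → sumFin n f ≤ sumFin n g
sumFin-mono zero    f≤g = ≤-refl
sumFin-mono (suc n) f≤g = +-mono-≤ (f≤g zero) (sumFin-mono n (λ j → f≤g (suc j)))

sumFin-+ : ∀ n (f g : Fin n → ℚ) → sumFin n (λ j → f j + g j) ≡ sumFin n f + sumFin n g
sumFin-+ zero    f g = refl
sumFin-+ (suc n) f g = begin
  (f zero + g zero) + sumFin n (λ j → f (suc j) + g (suc j))
    ≡⟨ cong (_+_ (f zero + g zero)) (sumFin-+ n (λ j → f (suc j)) (λ j → g (suc j))) ⟩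
  (f zero + g zero) + (sumFin n (λ j → f (suc j)) + sumFin n (λ j → g (suc j)))
    ≡⟨ +-interchange (f zero) (g zero) _ _ ⟩
  (f zero + sumFin n (λ j → f (suc j))) + (g zero + sumFin n (λ j → g (suc j))) ∎
  where open ≡-Reasoning

sumFin-pos⇒∃-pos : ∀ n {g : Fin n → ℚ} → 0ℚ < sumFin n g → ∃ λ j → 0ℚ < g j
sumFin-pos⇒∃-pos zero 0<0 = ⊥-elim (<-irrefl refl 0<0)
sumFin-pos⇒∃-pos (suc n) {g} 0<Σg with 0ℚ <? g zero
... | yes 0<g₀ = zero , 0<g₀
... | no  0≮g₀ = let j , 0<gⱼ = sumFin-pos⇒∃-pos n 0<Σrest in suc j , 0<gⱼ
  where
  0<Σrest : 0ℚ < sumFin n (λ j → g (suc j))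
  0<Σrest = <-≤-trans 0<Σg (≤-trans (+-monoˡ-≤ _ (≮⇒≥ 0≮g₀)) (≤-reflexive (+-identityˡ _)))

sumFin-⊥ : ∀ n (g : Fin n → ℚ) → sumFin n (λ j → if lookup ⊥ j then g j else 0ℚ) ≡ 0ℚ
sumFin-⊥ zero    g = refl
sumFin-⊥ (suc n) g = trans (+-identityˡ _) (sumFin-⊥ n (λ j → g (suc j)))

sumFin-⁅⁆ : ∀ n (y : Fin n) (g : Fin n → ℚ) → sumFin n (λ j → if lookup ⁅ y ⁆ j then g j else 0ℚ) ≡ g y
sumFin-⁅⁆ (suc n) zero    g =
  trans (cong (_+_ (g zero)) (sumFin-⊥ n (λ j → g (suc j)))) (+-identityʳ (g zero))
sumFin-⁅⁆ (suc n) (suc y) g = trans (+-identityˡ _) (sumFin-⁅⁆ n y (λ j → g (suc j)))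

sumFin-const-on : ∀ n (p : Subset n) x → sumFin n (λ j → if lookup p j then x else 0ℚ) ≡ x * fromℕ ∣ p ∣
sumFin-const-on zero    []          x = sym (*-zeroʳ x)
sumFin-const-on (suc n) (false ∷ p) x = trans (+-identityˡ _) (sumFin-const-on n p x)
sumFin-const-on (suc n) (true ∷ p)  x = begin
  x + sumFin n (λ j → if lookup p j then x else 0ℚ)  ≡⟨ cong (_+_ x) (sumFin-const-on n p x) ⟩
  x + x * fromℕ ∣ p ∣
    ≡⟨ solve 2 (λ x m → x :+ x :* m := x :* (con 1ℚ :+ m)) refl x (fromℕ ∣ p ∣) ⟩
  x * (1ℚ + fromℕ ∣ p ∣)                             ≡⟨ cong (x *_) (sym (fromℕ-suc ∣ p ∣)) ⟩
  x * fromℕ (suc ∣ p ∣)                              ∎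
  where
  open ≡-Reasoning
  open +-*-Solver

x∈p⇒1≤∣p∣ : ∀ {n} {x : Fin n} {p : Subset n} → x ∈ p → 1 ℕ.≤ ∣ p ∣
x∈p⇒1≤∣p∣ {x = x} {p} x∈p = subst (ℕ._≤ ∣ p ∣) (∣⁅x⁆∣≡1 x) (p⊆q⇒∣p∣≤∣q∣ ⁅x⁆⊆p)
  where
  ⁅x⁆⊆p : ⁅ x ⁆ ⊆ p
  ⁅x⁆⊆p y∈⁅x⁆ = subst (_∈ p) (sym (x∈⁅y⁆⇒x≡y x y∈⁅x⁆)) x∈p

module _ {nF nD : ℕ} (I : Instance nF nD) where
  open Instance I

  costAvg-< : ∀ C {x} → 1 ℕ.≤ ∣ clients C ∣ → cost I C < x * fromℕ ∣ clients C ∣ → costAvg I C < x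
  costAvg-< C {x} with ∣ clients C ∣
  ... | zero  = λ ()
  ... | suc n = λ _ cost< → begin-strict
    cost I C * (+ 1 / suc n)             <⟨ *-monoˡ-<-pos (+ 1 / suc n) {{normalize-pos 1 (suc n)}} cost< ⟩
    (x * fromℕ (suc n)) * (+ 1 / suc n)  ≡⟨ *-assoc x (fromℕ (suc n)) (+ 1 / suc n) ⟩
    x * (fromℕ (suc n) * (+ 1 / suc n))  ≡⟨ cong (x *_) (fromℕ-inverse n) ⟩
    x * 1ℚ                               ≡⟨ *-identityʳ x ⟩
    x                                    ∎
    where open ≤-Reasoning

  satellite : Fin nF → Fin nD → Cluster nF nD
  satellite i j = cluster i ⁅ j ⁆ false

  satellite-wf : ∀ i j → WFCluster I (satellite i j)
  satellite-wf i j = ℕ.≤-reflexive (sym (∣⁅x⁆∣≡1 j)) , λ _ → ∣⁅x⁆∣≡1 j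

  costAvg-satellite-< : ∀ {i j x} → d i j < x → costAvg I (satellite i j) < x
  costAvg-satellite-< {i} {j} {x} d<x = costAvg-< (satellite i j) (proj₁ (satellite-wf i j)) (begin-strict
    0ℚ + sumFin nD (λ j′ → if lookup ⁅ j ⁆ j′ then d i j′ else 0ℚ)  ≡⟨ +-identityˡ _ ⟩
    sumFin nD (λ j′ → if lookup ⁅ j ⁆ j′ then d i j′ else 0ℚ)       ≡⟨ sumFin-⁅⁆ nD j (d i) ⟩
    d i j                                                         <⟨ d<x ⟩
    x                                                             ≡⟨ sym (*-identityʳ x) ⟩
    x * fromℕ 1                                                   ≡⟨ cong (λ m → x * fromℕ m) (sym (∣⁅x⁆∣≡1 j)) ⟩
    x * fromℕ ∣ ⁅ j ⁆ ∣                                             ∎)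
    where open ≤-Reasoning

  κ*-exists : ∀ i j → ∃ λ κ → IsKappa I i j κ
  κ*-exists i j =
    let s , 2ˢ≤d , d<2ˢ⁺¹ = pow2-bracket (d i j) (d-pos i j) in
    s ℤ.+ + 4 ,
    subst (λ z → pow2 z ≤ d i j) (sym (trans (ℤ.+-assoc s (+ 4) (ℤ.- + 4)) (ℤ.+-identityʳ s))) 2ˢ≤d ,
    subst (λ z → d i j < pow2 z) (sym (ℤ.+-assoc s (+ 4) (ℤ.- + 3))) d<2ˢ⁺¹

  KappaLe-of-< : ∀ {i j k} → d i j < pow2 (k ℤ.- + 3) → KappaLe I i j k
  KappaLe-of-< {i} {j} {k} d<2ᵏ⁻³ = κ , isκ , ℤ.≮⇒≥ k≮κ
    where
    κ = proj₁ (κ*-exists i j)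
    isκ = proj₂ (κ*-exists i j)
    k≮κ : ¬ (k ℤ.< κ)
    k≮κ k<κ = <-irrefl refl (<-≤-trans d<2ᵏ⁻³ (≤-trans (pow2-mono-≤ k-3≤κ-4) (proj₁ isκ)))
      where
      k-3≤κ-4 : k ℤ.- + 3 ℤ.≤ κ ℤ.- + 4
      k-3≤κ-4 = subst (ℤ._≤ κ ℤ.- + 4) (ℤ.+-assoc k (+ 1) (ℤ.- + 4))
                      (ℤ.+-monoˡ-≤ (ℤ.- + 4) (i<j⇒i+1≤j k<κ))


module NiceClustering {nF nD : ℕ} (I : Instance nF nD) (𝒞 : Clustering I) (nice : Nice I 𝒞) where
  open Instance I
  open Nice nice

  ℓ : Fin nD → ℤ
  ℓ = clientLevel 𝒞

  α̂ : Fin nD → ℚ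
  α̂ = αhat I 𝒞

  α̂≡pow2 : ∀ j → α̂ j ≡ pow2 (ℓ j ℤ.- + 10)
  α̂≡pow2 j = pow2-/1024 (ℓ j)

  pow2≤d-critical : ∀ {c j k} → critical (cl 𝒞 c) ≡ true → level 𝒞 c ℤ.≤ k → k ℤ.< ℓ j →
                    pow2 (k ℤ.- + 3) ≤ d (fac (cl 𝒞 c)) j
  pow2≤d-critical {c} {j} {k} crit c≤k k<ℓj = ≮⇒≥ λ d<2ᵏ⁻³ →
    I4 k (satellite I (fac (cl 𝒞 c)) j)
      ( satellite-wf I (fac (cl 𝒞 c)) j
      , costAvg-satellite-< I d<2ᵏ⁻³
      , (λ j′ j′∈⁅j⁆ → subst (λ j″ → k ℤ.< ℓ j″ × KappaLe I (fac (cl 𝒞 c)) j″ k)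
                             (sym (x∈⁅y⁆⇒x≡y j j′∈⁅j⁆)) (k<ℓj , KappaLe-of-< I d<2ᵏ⁻³))
      , (λ _ → c , refl , crit , c≤k)
      , λ ())

  d-assigned-< : ∀ j → d (fac (cl 𝒞 (assign 𝒞 j))) j < pow2 (ℓ j ℤ.- + 3)
  d-assigned-< j =
    let κ , (_ , d<2ᵏ⁻³) , κ≤ℓj = I3 (assign 𝒞 j) j (assign-spec₁ 𝒞 j)
    in <-≤-trans d<2ᵏ⁻³ (pow2-mono-≤ (ℤ.+-monoˡ-≤ (ℤ.- + 3) κ≤ℓj))

  Contributes : Fin nF → Fin nD → Set
  Contributes i j = d i j < α̂ j

  contributes⇒d< : ∀ {i j} → Contributes i j → d i j < pow2 (ℓ j ℤ.- + 10)
  contributes⇒d< {j = j} = subst (_ <_) (α̂≡pow2 j)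

  -- If ℓ j′ ≥ ℓ j + 2, then j′ lies within 2^(ℓ j′ - 4) of the facility i′ serving j (via j and i),
  -- so the satellite (i′, {j′}) would block at level ℓ j′ - 1.
  contributors-level-gap : ∀ {i j j′} → Contributes i j → Contributes i j′ → ℓ j′ ℤ.≤ ℓ j ℤ.+ + 1
  contributors-level-gap {i} {j} {j′} cj cj′ = ℤ.≮⇒≥ λ gap →
    let c* , fac≡i′ , crit = crit-exists 𝒞 i′ (assign 𝒞 j , refl)
        c*≤k = ℤ.≤-trans (I2 c* (assign 𝒞 j) crit fac≡i′)
                         (i<j⇒i≤j-1 (ℤ.≤-<-trans (ℤ.i≤i+j (ℓ j) (+ 1)) gap))
        2ᵏ⁻³≤d = subst (λ i″ → pow2 (k ℤ.- + 3) ≤ d i″ j′) fac≡i′ (pow2≤d-critical crit c*≤k (i-1<i x))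
    in <-irrefl refl (<-≤-trans (d<2ᵏ⁻³ gap) 2ᵏ⁻³≤d)
    where
    x = ℓ j′
    k = x ℤ.- + 1
    i′ = fac (cl 𝒞 (assign 𝒞 j))
    d<2ᵏ⁻³ : ℓ j ℤ.+ + 1 ℤ.< x → d i′ j′ < pow2 (k ℤ.- + 3)
    d<2ᵏ⁻³ gap = begin-strict
      d i′ j′                                               ≤⟨ triangle i′ i j′ j ⟩
      (d i′ j + d i j) + d i j′                             <⟨ +-mono-< (+-mono-< d-i′j d-ij) d-ij′ ⟩
      (pow2 (x ℤ.- + 5) + pow2 (x ℤ.- + 6)) + pow2 (x ℤ.- + 6)
        ≡⟨ +-assoc (pow2 (x ℤ.- + 5)) _ _ ⟩
      pow2 (x ℤ.- + 5) + (pow2 (x ℤ.- + 6) + pow2 (x ℤ.- + 6))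
        ≡⟨ cong (_+_ (pow2 (x ℤ.- + 5))) (pow2-double x (ℤ.- + 6)) ⟩
      pow2 (x ℤ.- + 5) + pow2 (x ℤ.- + 5)                   ≡⟨ pow2-double x (ℤ.- + 5) ⟩
      pow2 (x ℤ.- + 4)                                      ≡⟨ cong pow2 (sym (ℤ.+-assoc x (ℤ.- + 1) (ℤ.- + 3))) ⟩
      pow2 (k ℤ.- + 3)                                      ∎
      where
      open ≤-Reasoning
      ℓj+2≤x : ℓ j ℤ.+ + 2 ℤ.≤ x
      ℓj+2≤x = subst (ℤ._≤ x) (ℤ.+-assoc (ℓ j) (+ 1) (+ 1)) (i<j⇒i+1≤j gap)
      ℓj+[2+b]≤x+b : ∀ b → ℓ j ℤ.+ (+ 2 ℤ.+ b) ℤ.≤ x ℤ.+ b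
      ℓj+[2+b]≤x+b b = subst (ℤ._≤ x ℤ.+ b) (ℤ.+-assoc (ℓ j) (+ 2) b) (ℤ.+-monoˡ-≤ b ℓj+2≤x)
      d-i′j : d i′ j < pow2 (x ℤ.- + 5)
      d-i′j = <-≤-trans (d-assigned-< j) (pow2-mono-≤ (ℓj+[2+b]≤x+b (ℤ.- + 5)))
      d-ij : d i j < pow2 (x ℤ.- + 6)
      d-ij = <-≤-trans (contributes⇒d< cj)
               (≤-trans (pow2-mono-≤ (ℓj+[2+b]≤x+b (ℤ.- + 12))) (pow2-offset-≤ x (ℤ.≤ᵇ⇒≤ _)))
      d-ij′ : d i j′ < pow2 (x ℤ.- + 6)
      d-ij′ = <-≤-trans (contributes⇒d< cj′) (pow2-offset-≤ x (ℤ.≤ᵇ⇒≤ _))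

  -- A critical cluster at i below level ℓ j would let the satellite (i, {j}) block at level ℓ j - 1.
  contributor-level-≤ : ∀ {i j c} → Contributes i j → fac (cl 𝒞 c) ≡ i → ℓ j ℤ.≤ level 𝒞 c
  contributor-level-≤ {i} {j} {c} cj fac≡i =
    let c* , fac*≡i , crit = crit-exists 𝒞 i (c , fac≡i)
    in ℤ.≤-trans (ℓj≤critical c* fac*≡i crit) (I2 c* c crit (trans fac*≡i (sym fac≡i)))
    where
    ℓj≤critical : ∀ c* → fac (cl 𝒞 c*) ≡ i → critical (cl 𝒞 c*) ≡ true → ℓ j ℤ.≤ level 𝒞 c*
    ℓj≤critical c* fac*≡i crit = ℤ.≮⇒≥ λ c*<ℓj → <-irrefl refl (begin-strict
      d i j                               <⟨ contributes⇒d< cj ⟩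
      pow2 (ℓ j ℤ.- + 10)                 ≤⟨ pow2-offset-≤ (ℓ j) (ℤ.≤ᵇ⇒≤ _) ⟩
      pow2 (ℓ j ℤ.- + 4)                  ≡⟨ cong pow2 (sym (ℤ.+-assoc (ℓ j) (ℤ.- + 1) (ℤ.- + 3))) ⟩
      pow2 ((ℓ j ℤ.- + 1) ℤ.- + 3)        ≤⟨ subst (λ i″ → pow2 ((ℓ j ℤ.- + 1) ℤ.- + 3) ≤ d i″ j) fac*≡i
                                               (pow2≤d-critical crit (i<j⇒i≤j-1 c*<ℓj) (i-1<i (ℓ j))) ⟩
      d i j                               ∎)
      where open ≤-Reasoning

  β-contributes : ∀ {i j} → Contributes i j → β I 𝒞 i j ≡ α̂ j - d i j
  β-contributes cj = 0⊔[p-q]≡p-q (<⇒≤ cj)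

  β-¬contributes : ∀ {i j} → ¬ Contributes i j → β I 𝒞 i j ≡ 0ℚ
  β-¬contributes ¬cj = 0⊔[p-q]≡0 (≮⇒≥ ¬cj)

  β-pos⇒contributes : ∀ {i j} → 0ℚ < β I 𝒞 i j → Contributes i j
  β-pos⇒contributes {i} {j} 0<β = by-cases (d i j <? α̂ j)
    where
    by-cases : Dec (Contributes i j) → Contributes i j
    by-cases (yes cj)  = cj
    by-cases (no  ¬cj) = ⊥-elim (<-irrefl (sym (β-¬contributes ¬cj)) 0<β)

  contributors : Fin nF → Subset nD
  contributors i = tabulate (λ j → does (d i j <? α̂ j))

  contributors-lookup : ∀ i j → lookup (contributors i) j ≡ does (d i j <? α̂ j)
  contributors-lookup i j = lookup∘tabulate (λ j → does (d i j <? α̂ j)) j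

  ∈-contributors⁺ : ∀ {i j} → Contributes i j → j ∈ contributors i
  ∈-contributors⁺ {i} {j} cj =
    lookup⇒[]= j (contributors i) (trans (contributors-lookup i j) (dec-true (d i j <? α̂ j) cj))

  ∈-contributors⁻ : ∀ {i j} → j ∈ contributors i → Contributes i j
  ∈-contributors⁻ {i} {j} j∈ =
    by-cases (d i j <? α̂ j) (trans (sym (contributors-lookup i j)) ([]=⇒lookup j∈))
    where
    by-cases : (c? : Dec (Contributes i j)) → does c? ≡ true → Contributes i j
    by-cases (yes cj) _  = cj
    by-cases (no  _)  ()

  β+[P]d≤[P]x : ∀ {i x} → (∀ j → Contributes i j → α̂ j ≤ x) → ∀ j →
                β I 𝒞 i j + (if lookup (contributors i) j then d i j else 0ℚ)
                  ≤ (if lookup (contributors i) j then x else 0ℚ)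
  β+[P]d≤[P]x {i} {x} α̂≤x j =
    subst (λ b → β I 𝒞 i j + (if b then d i j else 0ℚ) ≤ (if b then x else 0ℚ))
          (sym (contributors-lookup i j)) (by-cases (d i j <? α̂ j))
    where
    by-cases : (c? : Dec (Contributes i j)) →
               β I 𝒞 i j + (if does c? then d i j else 0ℚ) ≤ (if does c? then x else 0ℚ)
    by-cases (yes cj)  = begin
      β I 𝒞 i j + d i j      ≡⟨ cong (_+ d i j) (β-contributes cj) ⟩
      (α̂ j - d i j) + d i j  ≡⟨ solve 2 (λ a b → (a :- b) :+ b := a) refl (α̂ j) (d i j) ⟩
      α̂ j                    ≤⟨ α̂≤x j cj ⟩
      x                      ∎
      where
      open ≤-Reasoning
      open +-*-Solver
    by-cases (no  ¬cj) = ≤-reflexive (trans (+-identityʳ _) (β-¬contributes ¬cj))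

  cost-contributors-< : ∀ {i x} → f i < sumFin nD (β I 𝒞 i) → (∀ j → Contributes i j → α̂ j ≤ x) →
                        cost I (cluster i (contributors i) true) < x * fromℕ ∣ contributors i ∣
  cost-contributors-< {i} {x} f<Σβ α̂≤x = begin-strict
    f i + sumFin nD [P]d                              <⟨ +-monoˡ-< (sumFin nD [P]d) f<Σβ ⟩
    sumFin nD (β I 𝒞 i) + sumFin nD [P]d              ≡⟨ sym (sumFin-+ nD (β I 𝒞 i) [P]d) ⟩
    sumFin nD (λ j → β I 𝒞 i j + [P]d j)              ≤⟨ sumFin-mono nD (β+[P]d≤[P]x α̂≤x) ⟩
    sumFin nD (λ j → if lookup P j then x else 0ℚ)    ≡⟨ sumFin-const-on nD P x ⟩
    x * fromℕ ∣ P ∣                                   ∎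
    where
    open ≤-Reasoning
    P = contributors i
    [P]d : Fin nD → ℚ
    [P]d j = if lookup P j then d i j else 0ℚ

  contributors-blocking : ∀ {i j₀} → Contributes i j₀ → f i < sumFin nD (β I 𝒞 i) →
                          Blocking I 𝒞 (ℓ j₀ ℤ.- + 2) (cluster i (contributors i) true)
  contributors-blocking {i} {j₀} cj₀ f<Σβ =
      wf-C
    , costAvg-< I C (proj₁ wf-C) (cost-contributors-< f<Σβ α̂≤2ᵏ⁻³)
    , (λ j j∈ → let cj = ∈-contributors⁻ j∈ in k<ℓ cj , KappaLe-of-< I (<-≤-trans cj (α̂≤2ᵏ⁻³ j cj)))
    , (λ ())
    , λ _ c fac≡i → ℤ.≤-trans (ℤ.i-j≤i (ℓ j₀) (+ 2)) (contributor-level-≤ cj₀ fac≡i)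
    where
    k = ℓ j₀ ℤ.- + 2
    C = cluster i (contributors i) true
    wf-C : WFCluster I C
    wf-C = x∈p⇒1≤∣p∣ (∈-contributors⁺ cj₀) , λ ()
    α̂≤2ᵏ⁻³ : ∀ j → Contributes i j → α̂ j ≤ pow2 (k ℤ.- + 3)
    α̂≤2ᵏ⁻³ j cj = begin
      α̂ j                               ≡⟨ α̂≡pow2 j ⟩
      pow2 (ℓ j ℤ.- + 10)               ≤⟨ pow2-mono-≤ (ℤ.+-monoˡ-≤ (ℤ.- + 10) (contributors-level-gap cj₀ cj)) ⟩
      pow2 ((ℓ j₀ ℤ.+ + 1) ℤ.- + 10)    ≡⟨ cong pow2 (ℤ.+-assoc (ℓ j₀) (+ 1) (ℤ.- + 10)) ⟩
      pow2 (ℓ j₀ ℤ.- + 9)               ≤⟨ pow2-offset-≤ (ℓ j₀) (ℤ.≤ᵇ⇒≤ _) ⟩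
      pow2 (ℓ j₀ ℤ.- + 5)               ≡⟨ cong pow2 (sym (ℤ.+-assoc (ℓ j₀) (ℤ.- + 2) (ℤ.- + 3))) ⟩
      pow2 (k ℤ.- + 3)                  ∎
      where open ≤-Reasoning
    k<ℓ : ∀ {j} → Contributes i j → k ℤ.< ℓ j
    k<ℓ {j} cj = ℤ.≤-<-trans (begin
      ℓ j₀ ℤ.- + 2                  ≤⟨ ℤ.+-monoˡ-≤ (ℤ.- + 2) (contributors-level-gap cj cj₀) ⟩
      (ℓ j ℤ.+ + 1) ℤ.- + 2         ≡⟨ ℤ.+-assoc (ℓ j) (+ 1) (ℤ.- + 2) ⟩
      ℓ j ℤ.- + 1                   ∎) (i-1<i (ℓ j))
      where open ℤ.≤-Reasoning

  sumFin-β≤f : ∀ i → sumFin nD (β I 𝒞 i) ≤ f i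
  sumFin-β≤f i = ≮⇒≥ λ f<Σβ →
    let j₀ , 0<βij₀ = sumFin-pos⇒∃-pos nD (≤-<-trans (f-nonneg i) f<Σβ)
    in I4 _ _ (contributors-blocking (β-pos⇒contributes 0<βij₀) f<Σβ)

  α̂-nonneg : ∀ j → 0ℚ ≤ α̂ j
  α̂-nonneg j = subst (0ℚ ≤_) (sym (α̂≡pow2 j)) (<⇒≤ (pow2-pos (ℓ j ℤ.- + 10)))

lemma4 : ∀ {nF nD : ℕ} (I : Instance nF nD) (𝒞 : Clustering I) →
         Nice I 𝒞 → LPFeasible I (αhat I 𝒞) (β I 𝒞)
lemma4 I 𝒞 nice =
    sumFin-β≤f
  , (λ i j → p-[0⊔[p-q]]≤q (α̂ j) (Instance.d I i j))
  , α̂-nonneg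
  , (λ i j → p≤p⊔q 0ℚ (α̂ j - Instance.d I i j))
  where open NiceClustering I 𝒞 nice
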